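{- Let $\lambda_0>0$ and let $k,m,f$ be positive integers. Let $A_1,\dots,A_k$ be pairwise disjoint sets, each of size $m$, and suppose that there exists an $(m,3,\lambda_0)$-expander. Then there is a graph $G$ on the vertex set $V=\bigcup_{i=1}^{k}A_i$ such that (1) $\Delta(G)\le 4^{f2^{k}}$; (2) there are no three vertices $x,y,z\in V$ with $x\in A_a$, $y\in A_b$, $z\in A_c$ for some $a<b<c$ such that $xy,xz\in E(G)$ but $yz\notin E(G)$; (3) for any $a\ne b$ and any subsets $X\subset A_a$, $Y\subset A_b$ with no edge of $G$ between $X$ and $Y$, we have $|X||Y|\le m^{2}(1+\lambda_0)^{ -f}$.
   Context: For a graph $H$ and $U\subseteq V(H)$, $N_H(U)$ is the set of vertices outside $U$ adjacent to some vertex of $U$, and $N_H[U]=U\cup N_H(U)$. A graph $H$ is an $(m,d,\lambda)$-expander if it is $d$-regular on $m$ vertices and every $U\subseteq V(H)$ with $|U|\le m/2$ satisfies $|N_H[U]|\ge(1+\lambda)|U|$. $\Delta(G)$ denotes the maximum degree of $G$.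
   Formalization: The constant $\lambda_0$ ranges over the positive rationals, both in the expander hypothesis and in the bound of (3). -}

module Defs where

open import Data.Bool using (Bool; true; false; _∨_; _∧_; if_then_else_)
open import Data.Nat as ℕ using (ℕ; zero; suc)
open import Data.Fin using (Fin; _<_)
open import Data.Fin.Subset using (Subset)
open import Data.Vec using (lookup; tabulate)
open import Data.List using (List; allFin; cartesianProduct; map)
open import Data.Nat.ListAction using (sum)
open import Data.Bool.ListAction using (any)
open import Data.Product using (_×_; _,_; proj₁; proj₂)
open import Data.Integer using (+_)
open import Data.Rational as ℚ using (ℚ; 1ℚ; _/_)
open import Relation.Binary.PropositionalEquality using (_≡_)

record SimpleGraph (V : Set) : Set where
  field
    adj    : V → V → Bool
    sym    : ∀ u v → adj u v ≡ adj v u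
    irrefl : ∀ v → adj v v ≡ false
open SimpleGraph public

degreeIn : {V : Set} → SimpleGraph V → List V → V → ℕ
degreeIn G vs v = sum (map (λ w → if adj G v w then 1 else 0) vs)

ℕtoℚ : ℕ → ℚ
ℕtoℚ n = (+ n) / 1

_^ℚ_ : ℚ → ℕ → ℚ
q ^ℚ zero  = 1ℚ
q ^ℚ suc n = q ℚ.* (q ^ℚ n)

closedNbhd : {m : ℕ} → SimpleGraph (Fin m) → Subset m → Subset m
closedNbhd {m} H U =
  tabulate (λ v → lookup U v ∨ any (λ u → lookup U u ∧ adj H u v) (allFin m))

IsExpander : (m d : ℕ) → ℚ → SimpleGraph (Fin m) → Set
IsExpander m d λ₀ H =
  (∀ v → degreeIn H (allFin m) v ≡ d) ×
  (∀ (U : Subset m) → 2 ℕ.* Data.Fin.Subset.∣ U ∣ ℕ.≤ m →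
     (1ℚ ℚ.+ λ₀) ℚ.* ℕtoℚ Data.Fin.Subset.∣ U ∣ ℚ.≤ ℕtoℚ Data.Fin.Subset.∣ closedNbhd H U ∣)

-- vertex set V = A_1 ∪ … ∪ A_k, with A_i = {i} × Fin m (pairwise disjoint, size m)
Vtx : ℕ → ℕ → Set
Vtx k m = Fin k × Fin m

allVtx : (k m : ℕ) → List (Vtx k m)
allVtx k m = cartesianProduct (allFin k) (allFin m)

-- Take k copies of the vertex set of the expander H, and for blocks a < b (numbered from 0)
-- join (a , x) to (b , y) when dist_H (x , y) ≤ rₐ = f · 2^(a+1).  Because the radii double from block to
-- block, two later neighbours (b , y), (c , z) of (a , x) satisfy dist (y , z) ≤ 2 rₐ ≤ r_b,
-- so they are adjacent.  A ball of radius r in a 3-regular graph has at most 4^r vertices and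
-- every radius in use is at most f · 2^(k-1), which bounds the degree by k · 4^(f 2^(k-1)).
-- If no edge joins X ⊆ A_a and Y ⊆ A_b, then dist (X , Y) > 2f, so the f-th closed
-- neighbourhoods of X and Y are disjoint and one of them, say that of X, has at most m/2
-- vertices; expansion then applies at each of the f steps, giving (1 + λ₀)^f |X| ≤ m,
-- while |Y| ≤ m.
module Submission where

open import Defs
open import Data.Bool using (Bool; true; false)
open import Data.Nat as ℕ using (ℕ; _^_)
open import Data.Fin using (Fin; _<_)
open import Data.Fin.Subset using (Subset; _∈_; ∣_∣)
open import Data.Product using (Σ; _×_; _,_)
open import Data.Rational as ℚ using (ℚ; 0ℚ; 1ℚ)
open import Relation.Binary.PropositionalEquality using (_≡_; _≢_)

open import Data.Bool using (T; _∨_; _∧_; if_then_else_)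
open import Data.Bool.ListAction using (any)
open import Data.Bool.Properties using (T-≡; T-∨; T-∧; ∨-zeroʳ)
open import Data.Empty using (⊥; ⊥-elim)
open import Data.Fin using (zero; suc; toℕ)
import Data.Fin.Properties as Finₚ
open import Data.Fin.Subset using (_∉_; _⊆_; ⁅_⁆)
open import Data.Fin.Subset.Properties
  using (x∈⁅x⁆; x∈⁅y⁆⇒x≡y; ∣⁅x⁆∣≡1; ∣p∣≤n; p⊆q⇒∣p∣≤∣q∣; x∉p⇒x∈∁p; ∣∁p∣≡n∸∣p∣)
open import Data.Integer using (+_; +≤+)
import Data.Integer.Properties as ℤ
open import Data.List using (List; []; _∷_; _++_; map; allFin; cartesianProduct; length)
open import Data.List.Membership.Propositional using (lose)
open import Data.List.Membership.Propositional.Properties using (∈-allFin)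
open import Data.List.Properties using (map-++; map-∘; map-tabulate; length-tabulate)
open import Data.List.Relation.Unary.Any using (satisfied)
open import Data.List.Relation.Unary.Any.Properties using (any⁺; any⁻)
open import Data.Nat using (zero; suc; z≤n; s≤s; _+_; _*_; _∸_; _≤_)
import Data.Nat.Coprimality as Coprime
open import Data.Nat.ListAction using (sum)
open import Data.Nat.ListAction.Properties using (sum-++)
open import Data.Nat.Properties
open import Data.Product using (∃-syntax)
import Data.Rational.Properties as ℚP
open import Data.Sum using (_⊎_; inj₁; inj₂)
open import Data.Vec using ([]; _∷_; lookup)
open import Data.Vec.Properties using (lookup∘tabulate; lookup⇒[]=; []=⇒lookup)
open import Function using (id)
open import Function.Bundles using (Equivalence)
open import Relation.Binary.Definitions using (tri<; tri≈; tri>)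
open import Relation.Binary.PropositionalEquality using (refl; trans; cong; cong₂; subst)
import Relation.Binary.PropositionalEquality as ≡

module _ {A : Set} where

  countᵇ : (A → Bool) → List A → ℕ
  countᵇ p xs = sum (map (λ x → if p x then 1 else 0) xs)

  countᵇ-mono : {p q : A → Bool} → (∀ x → p x ≡ true → q x ≡ true) →
                ∀ xs → countᵇ p xs ≤ countᵇ q xs
  countᵇ-mono p⇒q [] = z≤n
  countᵇ-mono {p} p⇒q (x ∷ xs) with p x in px
  ... | false = m≤n⇒m≤o+n _ (countᵇ-mono p⇒q xs)
  ... | true rewrite p⇒q x px = s≤s (countᵇ-mono p⇒q xs)

  countᵇ-false : ∀ xs → countᵇ (λ _ → false) xs ≡ 0
  countᵇ-false []       = refl
  countᵇ-false (_ ∷ xs) = countᵇ-false xs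

  countᵇ-∨ : (p q : A → Bool) → ∀ xs →
             countᵇ (λ x → p x ∨ q x) xs ≤ countᵇ p xs + countᵇ q xs
  countᵇ-∨ p q [] = z≤n
  countᵇ-∨ p q (x ∷ xs) with p x | q x | countᵇ-∨ p q xs
  ... | true  | _     | ih = s≤s (≤-trans ih (+-monoʳ-≤ (countᵇ p xs) (m≤n+m _ _)))
  ... | false | true  | ih = ≤-trans (s≤s ih) (≤-reflexive (≡.sym (+-suc _ _)))
  ... | false | false | ih = ih

  countᵇ-any : {B : Set} (r : B → A → Bool) → ∀ ys xs →
               countᵇ (λ x → any (λ y → r y x) ys) xs ≤ sum (map (λ y → countᵇ (r y) xs) ys)
  countᵇ-any r []       xs = ≤-reflexive (countᵇ-false xs)
  countᵇ-any r (y ∷ ys) xs =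
    ≤-trans (countᵇ-∨ (r y) _ xs) (+-monoʳ-≤ (countᵇ (r y) xs) (countᵇ-any r ys xs))

sum-map-≤-length* : {A : Set} (f : A → ℕ) {c : ℕ} → (∀ x → f x ≤ c) →
                    ∀ xs → sum (map f xs) ≤ length xs * c
sum-map-≤-length* f f≤c []       = z≤n
sum-map-≤-length* f f≤c (x ∷ xs) = +-mono-≤ (f≤c x) (sum-map-≤-length* f f≤c xs)

sum-map-≤-*countᵇ : {A : Set} (f : A → ℕ) (p : A → Bool) {d : ℕ} →
                    (∀ x → f x ≤ (if p x then d else 0)) →
                    ∀ xs → sum (map f xs) ≤ d * countᵇ p xs
sum-map-≤-*countᵇ f p f≤ [] = z≤n
sum-map-≤-*countᵇ f p {d} f≤ (x ∷ xs) with p x | f≤ x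
... | true  | fx≤d = ≤-trans (+-mono-≤ fx≤d (sum-map-≤-*countᵇ f p f≤ xs))
                             (≤-reflexive (≡.sym (*-suc d (countᵇ p xs))))
... | false | fx≤0 = +-mono-≤ fx≤0 (sum-map-≤-*countᵇ f p f≤ xs)

sum-map-cartesianProduct : {A B : Set} (f : A × B → ℕ) (xs : List A) (ys : List B) →
  sum (map f (cartesianProduct xs ys)) ≡ sum (map (λ x → sum (map (λ y → f (x , y)) ys)) xs)
sum-map-cartesianProduct f []       ys = refl
sum-map-cartesianProduct f (x ∷ xs) ys = begin
  sum (map f (map (x ,_) ys ++ cartesianProduct xs ys))
    ≡⟨ cong sum (map-++ f (map (x ,_) ys) _) ⟩
  sum (map f (map (x ,_) ys) ++ map f (cartesianProduct xs ys))
    ≡⟨ sum-++ (map f (map (x ,_) ys)) _ ⟩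
  sum (map f (map (x ,_) ys)) + sum (map f (cartesianProduct xs ys))
    ≡⟨ cong₂ _+_ (cong sum (≡.sym (map-∘ ys))) (sum-map-cartesianProduct f xs ys) ⟩
  sum (map (λ y → f (x , y)) ys) + sum (map (λ x → sum (map (λ y → f (x , y)) ys)) xs) ∎
  where open ≡.≡-Reasoning

countᵇ-allFin-suc : ∀ {n} (p : Fin (suc n) → Bool) →
  countᵇ p (allFin (suc n)) ≡ (if p zero then 1 else 0) + countᵇ (λ i → p (suc i)) (allFin n)
countᵇ-allFin-suc p = cong (λ xs → (if p zero then 1 else 0) + sum xs)
  (trans (map-tabulate suc (λ i → if p i then 1 else 0))
         (≡.sym (map-tabulate id (λ i → if p (suc i) then 1 else 0))))

∣p∣≡countᵇ : ∀ {n} (p : Subset n) → ∣ p ∣ ≡ countᵇ (lookup p) (allFin n)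
∣p∣≡countᵇ []          = refl
∣p∣≡countᵇ (true ∷ p)  =
  trans (cong suc (∣p∣≡countᵇ p)) (≡.sym (countᵇ-allFin-suc (lookup (true ∷ p))))
∣p∣≡countᵇ (false ∷ p) =
  trans (∣p∣≡countᵇ p) (≡.sym (countᵇ-allFin-suc (lookup (false ∷ p))))

m+n≤o⇒2*m≤o⊎2*n≤o : ∀ {m n o} → m + n ≤ o → 2 * m ≤ o ⊎ 2 * n ≤ o
m+n≤o⇒2*m≤o⊎2*n≤o {m} {n} m+n≤o with ≤-total m n
... | inj₁ m≤n = inj₁ (≤-trans (+-monoʳ-≤ m (≤-trans (≤-reflexive (+-identityʳ m)) m≤n)) m+n≤o)
... | inj₂ n≤m = inj₂ (≤-trans (+-mono-≤ n≤m (≤-reflexive (+-identityʳ n))) m+n≤o)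

disjoint⇒2*∣p∣≤n⊎2*∣q∣≤n : ∀ {n} (p q : Subset n) → (∀ {v} → v ∈ p → v ∈ q → ⊥) →
                           2 * ∣ p ∣ ≤ n ⊎ 2 * ∣ q ∣ ≤ n
disjoint⇒2*∣p∣≤n⊎2*∣q∣≤n {n} p q disjoint = m+n≤o⇒2*m≤o⊎2*n≤o {∣ p ∣} {∣ q ∣} (begin
  ∣ p ∣ + ∣ q ∣ ≡⟨ +-comm ∣ p ∣ ∣ q ∣ ⟩
  ∣ q ∣ + ∣ p ∣ ≤⟨ m≤o∸n⇒m+n≤o ∣ q ∣ (∣p∣≤n p) ∣q∣≤n∸∣p∣ ⟩
  n             ∎)
  where
    open ≤-Reasoning
    ∣q∣≤n∸∣p∣ : ∣ q ∣ ≤ n ∸ ∣ p ∣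
    ∣q∣≤n∸∣p∣ = ≤-trans (p⊆q⇒∣p∣≤∣q∣ (λ v∈q → x∉p⇒x∈∁p (λ v∈p → disjoint v∈p v∈q)))
                        (≤-reflexive (∣∁p∣≡n∸∣p∣ p))

n<2^n : ∀ n → n ℕ.< 2 ^ n
n<2^n zero    = s≤s z≤n
n<2^n (suc n) = +-mono-≤ (m^n>0 2 n) (≤-trans (n<2^n n) (m≤m+n (2 ^ n) 0))

m*2^[1+n]≡m*2^n+m*2^n : ∀ m n → m * 2 ^ suc n ≡ m * 2 ^ n + m * 2 ^ n
m*2^[1+n]≡m*2^n+m*2^n m n = trans (*-distribˡ-+ m (2 ^ n) (2 ^ n + 0))
                                  (cong (λ t → m * 2 ^ n + m * t) (+-identityʳ (2 ^ n)))

ℕtoℚ≡mkℚ : ∀ n → ℕtoℚ n ≡ ℚ.mkℚ (+ n) 0 (Coprime.sym (Coprime.1-coprimeTo n))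
ℕtoℚ≡mkℚ n = ℚP.normalize-coprime (Coprime.sym (Coprime.1-coprimeTo n))

ℕtoℚ-mono : ∀ {a b} → a ≤ b → ℕtoℚ a ℚ.≤ ℕtoℚ b
ℕtoℚ-mono {a} {b} a≤b rewrite ℕtoℚ≡mkℚ a | ℕtoℚ≡mkℚ b =
  ℚ.*≤* (ℤ.*-monoʳ-≤-nonNeg (+ 1) (+≤+ a≤b))

ℕtoℚ-* : ∀ a b → ℕtoℚ (a * b) ≡ ℕtoℚ a ℚ.* ℕtoℚ b
ℕtoℚ-* a b rewrite ℕtoℚ≡mkℚ a | ℕtoℚ≡mkℚ b = cong (ℚ._/ 1) (ℤ.pos-* a b)

ℕtoℚ-nonNeg : ∀ n → ℚ.NonNegative (ℕtoℚ n)
ℕtoℚ-nonNeg n = ℚP.normalize-nonNeg n 1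

module Neighbourhoods {m : ℕ} (H : SimpleGraph (Fin m)) where

  N[_] : Subset m → Subset m
  N[ U ] = closedNbhd H U

  lookup-N[] : ∀ U v →
    lookup N[ U ] v ≡ (lookup U v ∨ any (λ u → lookup U u ∧ adj H u v) (allFin m))
  lookup-N[] U v = lookup∘tabulate _ v

  ⊆-N[] : ∀ {U} → U ⊆ N[ U ]
  ⊆-N[] {U} {v} v∈U = lookup⇒[]= v N[ U ] (trans (lookup-N[] U v)
    (cong (_∨ any (λ u → lookup U u ∧ adj H u v) (allFin m)) ([]=⇒lookup v∈U)))

  ∈-N[]⁺ : ∀ {U u v} → u ∈ U → adj H u v ≡ true → v ∈ N[ U ]
  ∈-N[]⁺ {U} {u} {v} u∈U uv = lookup⇒[]= v N[ U ] (begin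
    lookup N[ U ] v                                            ≡⟨ lookup-N[] U v ⟩
    lookup U v ∨ any (λ w → lookup U w ∧ adj H w v) (allFin m)
      ≡⟨ cong (lookup U v ∨_) (Equivalence.to T-≡ (any⁺ _ (lose (∈-allFin u) u-witness))) ⟩
    lookup U v ∨ true                                          ≡⟨ ∨-zeroʳ _ ⟩
    true                                                       ∎)
    where
      open ≡.≡-Reasoning
      u-witness : T (lookup U u ∧ adj H u v)
      u-witness = Equivalence.from T-≡ (cong₂ _∧_ ([]=⇒lookup u∈U) uv)

  private
    T-lookup⇒∈ : ∀ {W : Subset m} {w} → T (lookup W w) → w ∈ W
    T-lookup⇒∈ {W} {w} t = lookup⇒[]= w W (Equivalence.to T-≡ t)

  ∈-N[]⁻ : ∀ {U v} → v ∈ N[ U ] → v ∈ U ⊎ ∃[ u ] u ∈ U × adj H u v ≡ true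
  ∈-N[]⁻ {U} {v} v∈NU with Equivalence.to T-∨ (Equivalence.from T-≡
                              (trans (≡.sym (lookup-N[] U v)) ([]=⇒lookup v∈NU)))
  ... | inj₁ v∈U = inj₁ (T-lookup⇒∈ v∈U)
  ... | inj₂ some-u with satisfied (any⁻ _ (allFin m) some-u)
  ...   | u , u-witness with Equivalence.to T-∧ u-witness
  ...     | u∈U , uv = inj₂ (u , T-lookup⇒∈ u∈U , Equivalence.to T-≡ uv)

  N[]-mono : ∀ {U W} → U ⊆ W → N[ U ] ⊆ N[ W ]
  N[]-mono U⊆W v∈NU with ∈-N[]⁻ v∈NU
  ... | inj₁ v∈U            = ⊆-N[] (U⊆W v∈U)
  ... | inj₂ (u , u∈U , uv) = ∈-N[]⁺ (U⊆W u∈U) uv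

  N[_]^_ : Subset m → ℕ → Subset m
  N[ U ]^ zero  = U
  N[ U ]^ suc r = N[ N[ U ]^ r ]

  N[]^-mono : ∀ r {U W} → U ⊆ W → N[ U ]^ r ⊆ N[ W ]^ r
  N[]^-mono zero    U⊆W = U⊆W
  N[]^-mono (suc r) U⊆W = N[]-mono (N[]^-mono r U⊆W)

  ⊆-N[]^ : ∀ r {U} → U ⊆ N[ U ]^ r
  ⊆-N[]^ zero    v∈U = v∈U
  ⊆-N[]^ (suc r) v∈U = ⊆-N[] (⊆-N[]^ r v∈U)

  N[]^-+ : ∀ r s U → N[ N[ U ]^ r ]^ s ≡ N[ U ]^ (s + r)
  N[]^-+ r zero    U = refl
  N[]^-+ r (suc s) U = cong N[_] (N[]^-+ r s U)

  N[]^-monoʳ : ∀ {r s} U → r ≤ s → N[ U ]^ r ⊆ N[ U ]^ s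
  N[]^-monoʳ {r} {s} U r≤s v∈ = subst (λ t → _ ∈ N[ U ]^ t) (m∸n+n≡m r≤s)
    (subst (_ ∈_) (N[]^-+ r (s ∸ r) U) (⊆-N[]^ (s ∸ r) v∈))

  ball : Fin m → ℕ → Subset m
  ball x r = N[ ⁅ x ⁆ ]^ r

  ball-trans : ∀ r s {x y z} → y ∈ ball x r → z ∈ ball y s → z ∈ ball x (r + s)
  ball-trans r s {x} {y} {z} y∈ z∈ = subst (λ t → z ∈ ball x t) (+-comm s r)
    (subst (z ∈_) (N[]^-+ r s ⁅ x ⁆) (N[]^-mono s ⁅y⁆⊆ z∈))
    where
      ⁅y⁆⊆ : ⁅ y ⁆ ⊆ ball x r
      ⁅y⁆⊆ w∈ = subst (_∈ ball x r) (≡.sym (x∈⁅y⁆⇒x≡y y w∈)) y∈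

  ball-sym : ∀ r {x y} → y ∈ ball x r → x ∈ ball y r
  ball-sym zero    {x} y∈ = subst (λ w → x ∈ ⁅ w ⁆) (≡.sym (x∈⁅y⁆⇒x≡y x y∈)) (x∈⁅x⁆ x)
  ball-sym (suc r) {x} {y} y∈ with ∈-N[]⁻ y∈
  ... | inj₁ y∈ball        = ⊆-N[] (ball-sym r y∈ball)
  ... | inj₂ (u , u∈ , uy) =
    ball-trans 1 r (∈-N[]⁺ (x∈⁅x⁆ y) (trans (SimpleGraph.sym H y u) uy)) (ball-sym r u∈)

  ∈-N[]^⁻ : ∀ r {U v} → v ∈ N[ U ]^ r → ∃[ u ] u ∈ U × v ∈ ball u r
  ∈-N[]^⁻ zero    {v = v} v∈U = v , v∈U , x∈⁅x⁆ v
  ∈-N[]^⁻ (suc r) v∈ with ∈-N[]⁻ v∈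
  ... | inj₁ v∈Nʳ with ∈-N[]^⁻ r v∈Nʳ
  ...   | u , u∈U , v∈ball = u , u∈U , ⊆-N[] v∈ball
  ∈-N[]^⁻ (suc r) v∈ | inj₂ (w , w∈Nʳ , wv) with ∈-N[]^⁻ r w∈Nʳ
  ...   | u , u∈U , w∈ball = u , u∈U , ∈-N[]⁺ w∈ball wv

  far-apart⇒N[]^-disjoint : ∀ r {X Y} → (∀ {x y} → x ∈ X → y ∈ Y → y ∉ ball x (r + r)) →
                            ∀ {v} → v ∈ N[ X ]^ r → v ∈ N[ Y ]^ r → ⊥
  far-apart⇒N[]^-disjoint r far v∈NX v∈NY with ∈-N[]^⁻ r v∈NX | ∈-N[]^⁻ r v∈NY
  ... | x , x∈X , v∈Bx | y , y∈Y , v∈By = far x∈X y∈Y (ball-trans r r v∈Bx (ball-sym r v∈By))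

  module _ {d : ℕ} (deg≤d : ∀ v → degreeIn H (allFin m) v ≤ d) where

    ∣N[]∣≤ : ∀ U → ∣ N[ U ] ∣ ≤ suc d * ∣ U ∣
    ∣N[]∣≤ U = begin
      ∣ N[ U ] ∣
        ≡⟨ ∣p∣≡countᵇ N[ U ] ⟩
      countᵇ (lookup N[ U ]) (allFin m)
        ≤⟨ countᵇ-mono (λ v → trans (≡.sym (lookup-N[] U v))) (allFin m) ⟩
      countᵇ (λ v → lookup U v ∨ any (λ u → edge u v) (allFin m)) (allFin m)
        ≤⟨ countᵇ-∨ (lookup U) _ (allFin m) ⟩
      ∣U∣ + countᵇ (λ v → any (λ u → edge u v) (allFin m)) (allFin m)
        ≤⟨ +-monoʳ-≤ ∣U∣ (countᵇ-any edge (allFin m) (allFin m)) ⟩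
      ∣U∣ + sum (map (λ u → countᵇ (edge u) (allFin m)) (allFin m))
        ≤⟨ +-monoʳ-≤ ∣U∣ (sum-map-≤-*countᵇ _ (lookup U) out-degree≤ (allFin m)) ⟩
      ∣U∣ + d * ∣U∣
        ≡⟨ cong (λ n → n + d * n) (∣p∣≡countᵇ U) ⟨
      suc d * ∣ U ∣ ∎
      where
        open ≤-Reasoning
        ∣U∣ : ℕ
        ∣U∣ = countᵇ (lookup U) (allFin m)
        edge : Fin m → Fin m → Bool
        edge u v = lookup U u ∧ adj H u v
        out-degree≤ : ∀ u → countᵇ (edge u) (allFin m) ≤ (if lookup U u then d else 0)
        out-degree≤ u with lookup U u
        ... | true  = deg≤d u
        ... | false = ≤-reflexive (countᵇ-false (allFin m))

    ∣ball∣≤ : ∀ x r → ∣ ball x r ∣ ≤ suc d ^ r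
    ∣ball∣≤ x zero    = ≤-reflexive (∣⁅x⁆∣≡1 x)
    ∣ball∣≤ x (suc r) = ≤-trans (∣N[]∣≤ (ball x r)) (*-monoʳ-≤ (suc d) (∣ball∣≤ x r))

module Expansion {m : ℕ} (H : SimpleGraph (Fin m)) {λ₀ : ℚ} (0≤λ₀ : 0ℚ ℚ.≤ λ₀)
  (expands : ∀ (U : Subset m) → 2 * ∣ U ∣ ≤ m →
             (1ℚ ℚ.+ λ₀) ℚ.* ℕtoℚ ∣ U ∣ ℚ.≤ ℕtoℚ ∣ closedNbhd H U ∣) where

  open Neighbourhoods H

  q : ℚ
  q = 1ℚ ℚ.+ λ₀

  instance
    q-nonNeg : ℚ.NonNegative q
    q-nonNeg = ℚP.nonNeg+nonNeg⇒nonNeg 1ℚ λ₀ {{ℚ.nonNegative 0≤λ₀}}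

  iterated-expansion : ∀ f S → 2 * ∣ N[ S ]^ f ∣ ≤ m →
                       (q ^ℚ f) ℚ.* ℕtoℚ ∣ S ∣ ℚ.≤ ℕtoℚ ∣ N[ S ]^ f ∣
  iterated-expansion zero    S _     = ℚP.≤-reflexive (ℚP.*-identityˡ _)
  iterated-expansion (suc f) S small = begin
    (q ℚ.* (q ^ℚ f)) ℚ.* ℕtoℚ ∣ S ∣ ≡⟨ ℚP.*-assoc q (q ^ℚ f) _ ⟩
    q ℚ.* ((q ^ℚ f) ℚ.* ℕtoℚ ∣ S ∣) ≤⟨ ℚP.*-monoˡ-≤-nonNeg q (iterated-expansion f S small′) ⟩
    q ℚ.* ℕtoℚ ∣ N[ S ]^ f ∣        ≤⟨ expands (N[ S ]^ f) small′ ⟩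
    ℕtoℚ ∣ N[ S ]^ suc f ∣          ∎
    where
      open ℚP.≤-Reasoning
      small′ : 2 * ∣ N[ S ]^ f ∣ ≤ m
      small′ = ≤-trans (*-monoʳ-≤ 2 (p⊆q⇒∣p∣≤∣q∣ (⊆-N[] {N[ S ]^ f}))) small

  product-bound : ∀ f S → 2 * ∣ N[ S ]^ f ∣ ≤ m → (T : Subset m) →
                  ℕtoℚ (∣ S ∣ * ∣ T ∣) ℚ.* (q ^ℚ f) ℚ.≤ ℕtoℚ (m ^ 2)
  product-bound f S small T = begin
    ℕtoℚ (∣ S ∣ * ∣ T ∣) ℚ.* (q ^ℚ f)        ≡⟨ cong (ℚ._* (q ^ℚ f)) (ℕtoℚ-* ∣ S ∣ ∣ T ∣) ⟩
    (ℕtoℚ ∣ S ∣ ℚ.* ℕtoℚ ∣ T ∣) ℚ.* (q ^ℚ f) ≡⟨ ℚP.*-comm _ (q ^ℚ f) ⟩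
    (q ^ℚ f) ℚ.* (ℕtoℚ ∣ S ∣ ℚ.* ℕtoℚ ∣ T ∣) ≡⟨ ℚP.*-assoc (q ^ℚ f) _ _ ⟨
    ((q ^ℚ f) ℚ.* ℕtoℚ ∣ S ∣) ℚ.* ℕtoℚ ∣ T ∣
      ≤⟨ ℚP.*-monoʳ-≤-nonNeg (ℕtoℚ ∣ T ∣) {{ℕtoℚ-nonNeg ∣ T ∣}} qᶠ∣S∣≤m ⟩
    ℕtoℚ m ℚ.* ℕtoℚ ∣ T ∣
      ≤⟨ ℚP.*-monoˡ-≤-nonNeg (ℕtoℚ m) {{ℕtoℚ-nonNeg m}} (ℕtoℚ-mono (∣p∣≤n T)) ⟩
    ℕtoℚ m ℚ.* ℕtoℚ m                        ≡⟨ ℕtoℚ-* m m ⟨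
    ℕtoℚ (m * m)                             ≡⟨ cong (λ n → ℕtoℚ (m * n)) (*-identityʳ m) ⟨
    ℕtoℚ (m ^ 2)                             ∎
    where
      open ℚP.≤-Reasoning
      qᶠ∣S∣≤m : (q ^ℚ f) ℚ.* ℕtoℚ ∣ S ∣ ℚ.≤ ℕtoℚ m
      qᶠ∣S∣≤m = ℚP.≤-trans (iterated-expansion f S small) (ℕtoℚ-mono (∣p∣≤n (N[ S ]^ f)))

  far-apart-bound : ∀ f (X Y : Subset m) → (∀ {x y} → x ∈ X → y ∈ Y → y ∉ ball x (f + f)) →
                    ℕtoℚ (∣ X ∣ * ∣ Y ∣) ℚ.* (q ^ℚ f) ℚ.≤ ℕtoℚ (m ^ 2)
  far-apart-bound f X Y far
    with disjoint⇒2*∣p∣≤n⊎2*∣q∣≤n (N[ X ]^ f) (N[ Y ]^ f) (far-apart⇒N[]^-disjoint f far)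
  ... | inj₁ X-small = product-bound f X X-small Y
  ... | inj₂ Y-small = subst (λ n → ℕtoℚ n ℚ.* (q ^ℚ f) ℚ.≤ ℕtoℚ (m ^ 2)) (*-comm ∣ Y ∣ ∣ X ∣)
                             (product-bound f Y Y-small X)

module Construction {m : ℕ} (H : SimpleGraph (Fin m)) (k′ f : ℕ) where

  open Neighbourhoods H

  radius : ℕ → ℕ
  radius i = f * 2 ^ suc i

  radius-double : ∀ {i j} → i ℕ.< j → radius i + radius i ≤ radius j
  radius-double {i} i<j = ≤-trans (≤-reflexive (≡.sym (m*2^[1+n]≡m*2^n+m*2^n f (suc i))))
                                  (*-monoʳ-≤ f (^-monoʳ-≤ 2 {suc (suc i)} (s≤s i<j)))

  f+f≤radius : ∀ i → f + f ≤ radius i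
  f+f≤radius i = begin
    f + f         ≡⟨ cong₂ _+_ (*-identityʳ f) (*-identityʳ f) ⟨
    f * 1 + f * 1 ≡⟨ m*2^[1+n]≡m*2^n+m*2^n f 0 ⟨
    f * 2 ^ 1     ≤⟨ *-monoʳ-≤ f (^-monoʳ-≤ 2 {1} {suc i} (s≤s z≤n)) ⟩
    radius i      ∎
    where open ≤-Reasoning

  within : ℕ → Fin m → Fin m → Bool
  within r x y = lookup (ball x r) y

  within⇒∈ : ∀ r x y → within r x y ≡ true → y ∈ ball x r
  within⇒∈ r x y = lookup⇒[]= y (ball x r)

  ∈⇒within : ∀ r x y → y ∈ ball x r → within r x y ≡ true
  ∈⇒within r x y = []=⇒lookup

  within-sym : ∀ r x y → within r x y ≡ true → within r y x ≡ true
  within-sym r x y xy = ∈⇒within r y x (ball-sym r (within⇒∈ r x y xy))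

  within-false⇒∉ : ∀ r x y → within r x y ≡ false → y ∉ ball x r
  within-false⇒∉ r x y not-within y∈ with trans (≡.sym not-within) (∈⇒within r x y y∈)
  ... | ()

  adjG : Vtx (suc k′) m → Vtx (suc k′) m → Bool
  adjG (a , x) (b , y) with Finₚ.<-cmp a b
  ... | tri< _ _ _ = within (radius (toℕ a)) x y
  ... | tri≈ _ _ _ = false
  ... | tri> _ _ _ = within (radius (toℕ b)) y x

  adjG-< : ∀ {a b} x y → a < b → adjG (a , x) (b , y) ≡ within (radius (toℕ a)) x y
  adjG-< {a} {b} x y a<b with Finₚ.<-cmp a b
  ... | tri< _ _ _   = refl
  ... | tri≈ a≮b _ _ = ⊥-elim (a≮b a<b)
  ... | tri> a≮b _ _ = ⊥-elim (a≮b a<b)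

  adjG-> : ∀ {a b} x y → b < a → adjG (a , x) (b , y) ≡ within (radius (toℕ b)) y x
  adjG-> {a} {b} x y b<a with Finₚ.<-cmp a b
  ... | tri< _ _ b≮a = ⊥-elim (b≮a b<a)
  ... | tri≈ _ _ b≮a = ⊥-elim (b≮a b<a)
  ... | tri> _ _ _   = refl

  adjG-≡ : ∀ a x y → adjG (a , x) (a , y) ≡ false
  adjG-≡ a x y with Finₚ.<-cmp a a
  ... | tri< a<a _ _ = ⊥-elim (Finₚ.<-irrefl refl a<a)
  ... | tri≈ _ _ _   = refl
  ... | tri> _ _ a<a = ⊥-elim (Finₚ.<-irrefl refl a<a)

  adjG-sym : ∀ u v → adjG u v ≡ adjG v u
  adjG-sym (a , x) (b , y) with Finₚ.<-cmp a b
  ... | tri< a<b _ _  = ≡.sym (adjG-> y x a<b)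
  ... | tri≈ _ refl _ = ≡.sym (adjG-≡ a y x)
  ... | tri> _ _ b<a  = ≡.sym (adjG-< y x b<a)

  G : SimpleGraph (Vtx (suc k′) m)
  G = record { adj = adjG ; sym = adjG-sym ; irrefl = λ (a , x) → adjG-≡ a x x }

  adjG-forward-triangle : ∀ (a b c : Fin (suc k′)) (x y z : Fin m) → a < b → b < c →
                          adjG (a , x) (b , y) ≡ true → adjG (a , x) (c , z) ≡ true →
                          adjG (b , y) (c , z) ≡ true
  adjG-forward-triangle a b c x y z a<b b<c xy xz = trans (adjG-< y z b<c)
    (∈⇒within (radius (toℕ b)) y z
      (N[]^-monoʳ ⁅ y ⁆ (radius-double a<b) (ball-trans r r (ball-sym r y∈) z∈)))
    where
      r : ℕ
      r = radius (toℕ a)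
      y∈ : y ∈ ball x r
      y∈ = within⇒∈ r x y (trans (≡.sym (adjG-< x y a<b)) xy)
      z∈ : z ∈ ball x r
      z∈ = within⇒∈ r x z (trans (≡.sym (adjG-< x z (Finₚ.<-trans a<b b<c))) xz)

  non-adjacent⇒far : ∀ {a b} → a ≢ b → ∀ {x y} → adjG (a , x) (b , y) ≡ false →
                     y ∉ ball x (f + f)
  non-adjacent⇒far {a} {b} a≢b {x} {y} xy with Finₚ.<-cmp a b
  ... | tri< _ _ _   = λ y∈ → within-false⇒∉ (radius (toℕ a)) x y xy
                                (N[]^-monoʳ ⁅ x ⁆ (f+f≤radius (toℕ a)) y∈)
  ... | tri≈ _ a≡b _ = ⊥-elim (a≢b a≡b)
  ... | tri> _ _ _   = λ y∈ → within-false⇒∉ (radius (toℕ b)) y x xy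
                                (N[]^-monoʳ ⁅ y ⁆ (f+f≤radius (toℕ b)) (ball-sym (f + f) y∈))

  module _ (deg≤3 : ∀ v → degreeIn H (allFin m) v ≤ 3) (1≤f : 1 ≤ f) where

    maxRadius : ℕ
    maxRadius = f * 2 ^ k′

    countᵇ-within≤ : ∀ {a b : Fin (suc k′)} x → a < b →
                     countᵇ (within (radius (toℕ a)) x) (allFin m) ≤ 4 ^ maxRadius
    countᵇ-within≤ {a} {b} x a<b = begin
      countᵇ (within (radius (toℕ a)) x) (allFin m) ≡⟨ ∣p∣≡countᵇ (ball x (radius (toℕ a))) ⟨
      ∣ ball x (radius (toℕ a)) ∣ ≤⟨ ∣ball∣≤ deg≤3 x (radius (toℕ a)) ⟩
      4 ^ radius (toℕ a)          ≤⟨ ^-monoʳ-≤ 4 (*-monoʳ-≤ f (^-monoʳ-≤ 2 a+1≤k′)) ⟩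
      4 ^ maxRadius               ∎
      where
        open ≤-Reasoning
        a+1≤k′ : suc (toℕ a) ≤ k′
        a+1≤k′ = ≤-trans a<b (Finₚ.toℕ≤pred[n] b)

    block-degree≤ : ∀ a x b → countᵇ (λ y → adjG (a , x) (b , y)) (allFin m) ≤ 4 ^ maxRadius
    block-degree≤ a x b with Finₚ.<-cmp a b
    ... | tri< a<b _ _  = countᵇ-within≤ x a<b
    ... | tri≈ _ refl _ = ≤-trans (≤-reflexive (countᵇ-false (allFin m))) z≤n
    ... | tri> _ _ b<a  = ≤-trans (countᵇ-mono (λ y → within-sym (radius (toℕ b)) y x) (allFin m))
                                  (countᵇ-within≤ x b<a)

    k≤4^maxRadius : suc k′ ≤ 4 ^ maxRadius
    k≤4^maxRadius = begin
      suc k′        ≤⟨ n<2^n k′ ⟩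
      2 ^ k′        ≡⟨ *-identityˡ (2 ^ k′) ⟨
      1 * 2 ^ k′    ≤⟨ *-monoˡ-≤ (2 ^ k′) 1≤f ⟩
      maxRadius     ≤⟨ <⇒≤ (n<2^n maxRadius) ⟩
      2 ^ maxRadius ≤⟨ ^-monoˡ-≤ maxRadius (s≤s (s≤s z≤n)) ⟩
      4 ^ maxRadius ∎
      where open ≤-Reasoning

    degree≤ : ∀ v → degreeIn G (allVtx (suc k′) m) v ≤ 4 ^ (f * 2 ^ suc k′)
    degree≤ (a , x) = begin
      degreeIn G (allVtx (suc k′) m) (a , x)
        ≡⟨ sum-map-cartesianProduct _ (allFin (suc k′)) (allFin m) ⟩
      sum (map (λ b → countᵇ (λ y → adjG (a , x) (b , y)) (allFin m)) (allFin (suc k′)))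
        ≤⟨ sum-map-≤-length* _ (block-degree≤ a x) (allFin (suc k′)) ⟩
      length (allFin (suc k′)) * 4 ^ maxRadius
        ≡⟨ cong (_* 4 ^ maxRadius) (length-tabulate {n = suc k′} id) ⟩
      suc k′ * 4 ^ maxRadius                   ≤⟨ *-monoˡ-≤ (4 ^ maxRadius) k≤4^maxRadius ⟩
      4 ^ maxRadius * 4 ^ maxRadius            ≡⟨ ^-distribˡ-+-* 4 maxRadius maxRadius ⟨
      4 ^ (maxRadius + maxRadius)              ≡⟨ cong (4 ^_) (m*2^[1+n]≡m*2^n+m*2^n f k′) ⟨
      4 ^ (f * 2 ^ suc k′)                     ∎
      where open ≤-Reasoning

lemma5 : (λ₀ : ℚ) → 0ℚ ℚ.< λ₀ → (k m f : ℕ) → 1 ℕ.≤ k → 1 ℕ.≤ m → 1 ℕ.≤ f →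
    Σ (SimpleGraph (Fin m)) (IsExpander m 3 λ₀) →
    Σ (SimpleGraph (Vtx k m)) λ G →
      (∀ (v : Vtx k m) → degreeIn G (allVtx k m) v ℕ.≤ 4 ^ (f ℕ.* 2 ^ k))
      × (∀ (a b c : Fin k) (x y z : Fin m) → a < b → b < c →
           adj G (a , x) (b , y) ≡ true → adj G (a , x) (c , z) ≡ true →
           adj G (b , y) (c , z) ≡ true)
      × (∀ (a b : Fin k) → a ≢ b → (X Y : Subset m) →
           (∀ (x y : Fin m) → x ∈ X → y ∈ Y → adj G (a , x) (b , y) ≡ false) →
           ℕtoℚ (∣ X ∣ ℕ.* ∣ Y ∣) ℚ.* ((1ℚ ℚ.+ λ₀) ^ℚ f) ℚ.≤ ℕtoℚ (m ^ 2))
lemma5 λ₀ 0<λ₀ zero     m f () _ _ _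
lemma5 λ₀ 0<λ₀ (suc k′) m f _  _ 1≤f (H , regular , expands) =
  G , degree≤ (λ v → ≤-reflexive (regular v)) 1≤f , adjG-forward-triangle ,
  λ a b a≢b X Y no-edges →
    far-apart-bound f X Y (λ x∈X y∈Y → non-adjacent⇒far a≢b (no-edges _ _ x∈X y∈Y))
  where
    open Construction H k′ f
    open Expansion H (ℚP.<⇒≤ 0<λ₀) expands
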